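{- Let $(Q,\mathcal S)$ be a hypergraph with $Q=\{q_1,\dots,q_m\}$ and $\mathcal S=\{S_1,\dots,S_n\}$, where $n\ge 2$, each $S_j\neq\emptyset$, and $S_n=Q$. Let $G'$ be the graph constructed from $(Q,\mathcal S)$ as described in the context. Then $(Q,\mathcal S)$ has a $2$-colouring if and only if $G'$ contains $C_6$ as a contraction.
   Context: A $2$-colouring of a hypergraph $(Q,\mathcal S)$ is a partition $(Q_1,Q_2)$ of $Q$ such that $Q_1\cap S\neq\emptyset$ and $Q_2\cap S\neq\emptyset$ for every $S\in\mathcal S$. $C_6$ is the cycle on $6$ vertices. Contracting an edge $uv$ means deleting $u,v$ and adding a new vertex adjacent to $(N(u)\cup N(v))\setminus\{u,v\}$ (no multiple edges or loops); $G'$ contains $H$ as a contraction if $H$ can be obtained from $G'$ by a sequence of edge contractions. The graph $G'$ is constructed as follows. Its vertex set consists of: the vertices $q_1,\dots,q_m$; vertices $S_1,\dots,S_n$; vertices $S_1',\dots,S_n'$; for every pair $(i,j)$ with $q_i\in S_j$ a vertex $q^i_j$ (the set of these is $Q'$); and four further vertices $u_1,v,w,x$. Its edges are: $q_iS_j'$ whenever $q_i\in S_j$; $S_jS_k'$ for all $j,k\in\{1,\dots,n\}$; $q^i_jq_i$ and $q^i_jS_j$ for every $q^i_j\in Q'$ (there is no edge $q_iS_j$); $u_1S_j$ for every $j$; $u_1v$; $wS_j'$ for every $j$; and $xv$, $xw$. There are no other edges. -}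

module Defs where

open import Data.Nat using (ℕ; zero; suc)
open import Data.Fin using (Fin; zero; suc)
import Data.Fin as Fin
open import Data.Fin.Subset using (Subset; _∈_; _∩_; _∪_; ∁; ⊤; ⊥; Nonempty)
open import Data.Vec using (Vec; _∷_; []; _[_]=_; here; there)
open import Data.Bool using (Bool; true; false; not; _∧_; T)
open import Data.Bool.Properties using (T-irrelevant)
open import Data.Unit using () renaming (⊤ to Unit; tt to ∗)
open import Data.Empty using () renaming (⊥ to Empty)
open import Data.Product using (Σ; ∃; _×_; _,_; proj₁; proj₂)
import Data.Product.Properties as ×P
open import Data.Sum using (_⊎_; inj₁; inj₂)
import Data.Sum.Properties as ⊎P
open import Function using (_∘_)
open import Function.Bundles using (_↔_; _⇔_; Inverse)
open import Relation.Nullary using (Dec; yes; no; ¬_; does)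
open import Relation.Nullary.Decidable using (map′)
open import Relation.Binary.Definitions using (DecidableEquality)
open import Relation.Binary.PropositionalEquality using (_≡_; refl; cong; sym; trans)
open import Level using (0ℓ)

-- All graphs we use are simple:
-- adjacency is symmetric and irreflexive, and contraction preserves this.

record Graph : Set₁ where
  field
    V   : Set
    _≟_ : DecidableEquality V
    E   : V → V → Set

open Graph public

-- Old vertices are those y with y ≠ u and y ≠ v
-- (expressed through the decidable equality, as a Bool-valued test so
-- that the proof component is irrelevant).

notUV : (G : Graph) → V G → V G → V G → Bool
notUV G u v y = not (does ((G ._≟_) y u)) ∧ not (does ((G ._≟_) y v))

OldV : (G : Graph) → V G → V G → Set
OldV G u v = Σ (V G) (λ y → T (notUV G u v y))

ContrV : (G : Graph) → V G → V G → Set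
ContrV G u v = OldV G u v ⊎ Unit

contrDec : (G : Graph) (u v : V G) → DecidableEquality (ContrV G u v)
contrDec G u v =
  ⊎P.≡-dec (×P.≡-dec (G ._≟_) (λ a b → yes (T-irrelevant a b)))
           (λ { ∗ ∗ → yes refl })

contrE : (G : Graph) (u v : V G) → ContrV G u v → ContrV G u v → Set
contrE G u v (inj₁ (x , _)) (inj₁ (y , _)) = E G x y
contrE G u v (inj₁ (x , _)) (inj₂ _)       = E G x u ⊎ E G x v
contrE G u v (inj₂ _)       (inj₁ (y , _)) = E G u y ⊎ E G v y
contrE G u v (inj₂ _)       (inj₂ _)       = Empty

contract : (G : Graph) (u v : V G) → E G u v → Graph
contract G u v _ = record
  { V   = ContrV G u v
  ; _≟_ = contrDec G u v
  ; E   = contrE G u v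
  }

_≅_ : Graph → Graph → Set
G ≅ H = Σ (V G ↔ V H) λ f →
          ∀ x y → E G x y ⇔ E H (Inverse.to f x) (Inverse.to f y)

data ContainsContraction : Graph → Graph → Set₁ where
  done : ∀ {G H} → G ≅ H → ContainsContraction G H
  step : ∀ {G H} (u v : V G) (e : E G u v) →
         ContainsContraction (contract G u v e) H → ContainsContraction G H

next6 : Fin 6 → Fin 6
next6 zero = suc zero
next6 (suc zero) = suc (suc zero)
next6 (suc (suc zero)) = suc (suc (suc zero))
next6 (suc (suc (suc zero))) = suc (suc (suc (suc zero)))
next6 (suc (suc (suc (suc zero)))) = suc (suc (suc (suc (suc zero))))
next6 (suc (suc (suc (suc (suc zero))))) = zero

C6 : Graph
C6 = record
  { V   = Fin 6
  ; _≟_ = Fin._≟_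
  ; E   = λ i j → (j ≡ next6 i) ⊎ (i ≡ next6 j)
  }

TwoColouring : {m n : ℕ} → (Fin n → Subset m) → Set
TwoColouring {m} {n} S =
  Σ (Subset m) λ Q₁ → Σ (Subset m) λ Q₂ →
    (Q₁ ∪ Q₂ ≡ ⊤) × (Q₁ ∩ Q₂ ≡ ⊥) ×
    (∀ j → Nonempty (Q₁ ∩ S j) × Nonempty (Q₂ ∩ S j))

∈-irrelevant : ∀ {m} {i : Fin m} {s : Subset m} (p q : i ∈ s) → p ≡ q
∈-irrelevant here here = refl
∈-irrelevant (there p) (there q) = cong there (∈-irrelevant p q)

module _ {m n : ℕ} (S : Fin n → Subset m) where

  data G'V : Set where
    q   : Fin m → G'V
    s   : Fin n → G'V
    s'  : Fin n → G'V
    qq  : (i : Fin m) (j : Fin n) → i ∈ S j → G'V   -- q^i_j  (q_i ∈ S_j)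
    u₁ v w x : G'V

  private
    Code : Set
    Code = Fin m ⊎ Fin n ⊎ Fin n ⊎ Σ (Fin m × Fin n) (λ p → proj₁ p ∈ S (proj₂ p)) ⊎ Fin 4

    enc : G'V → Code
    enc (q i) = inj₁ i
    enc (s j) = inj₂ (inj₁ j)
    enc (s' j) = inj₂ (inj₂ (inj₁ j))
    enc (qq i j p) = inj₂ (inj₂ (inj₂ (inj₁ ((i , j) , p))))
    enc u₁ = inj₂ (inj₂ (inj₂ (inj₂ zero)))
    enc v = inj₂ (inj₂ (inj₂ (inj₂ (suc zero))))
    enc w = inj₂ (inj₂ (inj₂ (inj₂ (suc (suc zero)))))
    enc x = inj₂ (inj₂ (inj₂ (inj₂ (suc (suc (suc zero))))))

    dec : Code → G'V
    dec (inj₁ i) = q i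
    dec (inj₂ (inj₁ j)) = s j
    dec (inj₂ (inj₂ (inj₁ j))) = s' j
    dec (inj₂ (inj₂ (inj₂ (inj₁ ((i , j) , p))))) = qq i j p
    dec (inj₂ (inj₂ (inj₂ (inj₂ zero)))) = u₁
    dec (inj₂ (inj₂ (inj₂ (inj₂ (suc zero))))) = v
    dec (inj₂ (inj₂ (inj₂ (inj₂ (suc (suc zero)))))) = w
    dec (inj₂ (inj₂ (inj₂ (inj₂ (suc (suc (suc zero))))))) = x

    dec-enc : ∀ y → dec (enc y) ≡ y
    dec-enc (q i) = refl
    dec-enc (s j) = refl
    dec-enc (s' j) = refl
    dec-enc (qq i j p) = refl
    dec-enc u₁ = refl
    dec-enc v = refl
    dec-enc w = refl
    dec-enc x = refl

    code≟ : DecidableEquality Code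
    code≟ = ⊎P.≡-dec Fin._≟_ (⊎P.≡-dec Fin._≟_ (⊎P.≡-dec Fin._≟_
              (⊎P.≡-dec (×P.≡-dec (×P.≡-dec Fin._≟_ Fin._≟_)
                                   (λ a b → yes (∈-irrelevant a b)))
                        Fin._≟_)))

  G'V≟ : DecidableEquality G'V
  G'V≟ a b = map′ (λ eq → trans (sym (dec-enc a)) (trans (cong dec eq) (dec-enc b)))
                  (cong enc) (code≟ (enc a) (enc b))

  G'E : G'V → G'V → Set
  G'E (q i)      (s' j)     = i ∈ S j
  G'E (s' j)     (q i)      = i ∈ S j
  G'E (s j)      (s' k)     = Unit
  G'E (s' k)     (s j)      = Unit
  G'E (qq i j _) (q i')     = i ≡ i'
  G'E (q i')     (qq i j _) = i ≡ i'
  G'E (qq i j _) (s j')     = j ≡ j'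
  G'E (s j')     (qq i j _) = j ≡ j'
  G'E u₁         (s j)      = Unit
  G'E (s j)      u₁         = Unit
  G'E u₁         v          = Unit
  G'E v          u₁         = Unit
  G'E w          (s' j)     = Unit
  G'E (s' j)     w          = Unit
  G'E x          v          = Unit
  G'E v          x          = Unit
  G'E x          w          = Unit
  G'E w          x          = Unit
  G'E _          _          = Empty

  G' : Graph
  G' = record { V = G'V ; _≟_ = G'V≟ ; E = G'E }

module Submission where

-- G′ contracts to C₆ exactly when it has a C₆-model: a map from its vertices
-- onto those of C₆ whose fibres ("bags") are nonempty and connected, such that
-- edges join equal or adjacent bags and every edge of C₆ is realised.
--
-- For finite loopless G and loopless H, a contraction of G to
-- H gives an H-model (pull the model back along each contraction; needs G
-- symmetric), and an H-model gives a contraction (contract edges inside bags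
-- until the bag map is injective, hence an isomorphism).
--
-- A 2-colouring (Q₁, Q₂) yields a C₆-model of G′ with the S_j
-- and Q₁ in one bag and the S_j′ and Q₂ in the next.  Conversely, in a C₆-model
-- the bag opposite S_n′ is {v}; this forces all S_j into one bag a and all S_j′
-- into an adjacent bag b, and connectivity of a and b gives each S_j an element
-- in bag a and one in bag b, so "q_i lies in bag a" is a 2-colouring.

open import Defs
open import Data.Bool using (T)
open import Data.Bool.Properties using (T-irrelevant)
open import Data.Empty using (⊥-elim) renaming (⊥ to Empty)
open import Data.Fin using (Fin; zero; suc; fromℕ)
import Data.Fin as Fin
open import Data.Fin.Properties using (all?)
open import Data.Fin.Subset using (Subset; ⊤; ⊥; Nonempty; _∈_; _∉_; _∩_; ∁)
open import Data.Fin.Subset.Properties using (∈⊤; ∉⊥; x∈p∩q⁺; x∈p∩q⁻; _∈?_; p∪∁p≡⊤; ∩-inverseʳ; x∉p⇒x∈∁p)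
open import Data.List using (List; []; _∷_; length; map; filter; concat; concatMap; allFin)
open import Data.List.Membership.Propositional using (lose) renaming (_∈_ to _∈ᴸ_)
open import Data.List.Membership.Propositional.Properties using (∈-map⁺; ∈-filter⁺; ∈-concat⁺′; ∈-concatMap⁺; ∈-allFin)
open import Data.List.Properties using (length-map; filter-notAll)
open import Data.List.Relation.Unary.Any using (here; there; any?; satisfied)
open import Data.Nat using (ℕ; zero; suc; _<_)
open import Data.Nat.Induction using (<-wellFounded)
open import Data.Product using (∃; ∃₂; _×_; _,_; proj₁; proj₂)
open import Data.Sum using (_⊎_; inj₁; inj₂; [_,_])
open import Data.Unit using (tt)
open import Data.Vec using (tabulate)
open import Data.Vec.Properties using (lookup∘tabulate; lookup⇒[]=; []=⇒lookup)
open import Function using (_∘_)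
open import Function.Bundles using (_⇔_; _↔_; mk⇔; mk↔ₛ′; Equivalence; Inverse)
open import Induction.WellFounded using (Acc; acc)
open import Relation.Binary.Definitions using (DecidableEquality)
open import Relation.Binary.PropositionalEquality
  using (_≡_; _≢_; refl; sym; trans; cong; subst; subst₂; module ≡-Reasoning)
open import Relation.Nullary using (Dec; yes; no; ¬_; ¬?; does)
open import Relation.Nullary.Decidable using (dec-true; toWitness; _×-dec_; _⊎-dec_; _→-dec_)

-- A Graph need not be simple, so symmetry and looplessness of adjacency
-- are assumed explicitly where they are needed.
Symmetric : Graph → Set
Symmetric G = ∀ y z → E G y z → E G z y

Loopless : Graph → Set
Loopless G = ∀ y → ¬ E G y y

Touch : (H : Graph) → V H → V H → Set
Touch H a b = a ≡ b ⊎ E H a b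

data Walk (G : Graph) (P : V G → Set) : V G → V G → Set where
  stay : ∀ {y} → Walk G P y y
  hop  : ∀ {y t z} → E G y t → P t → Walk G P t z → Walk G P y z

module _ {G : Graph} {P : V G → Set} where

  _++ʷ_ : ∀ {y z t} → Walk G P y z → Walk G P z t → Walk G P y t
  stay       ++ʷ r′ = r′
  hop e pt r ++ʷ r′ = hop e pt (r ++ʷ r′)

  reverse : Symmetric G → ∀ {y z} → P y → Walk G P y z → Walk G P z y
  reverse sym-G py stay                 = stay
  reverse sym-G py (hop {y} {t} e pt r) = reverse sym-G pt r ++ʷ hop (sym-G y t e) py stay

  first-hop : ∀ {y z} → Walk G P y z → y ≢ z → ∃ λ t → E G y t × P t
  first-hop stay         y≢z = ⊥-elim (y≢z refl)
  first-hop (hop e pt _) _   = _ , e , pt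

  exit : (X : V G → Set) → (∀ t → Dec (X t)) → ∀ {y z} → Walk G P y z → X y → ¬ X z →
         ∃₂ λ y′ z′ → X y′ × ¬ X z′ × E G y′ z′ × P z′
  exit X X? stay                 xy ¬xz = ⊥-elim (¬xz xy)
  exit X X? (hop {y} {t} e pt r) xy ¬xz with X? t
  ... | yes xt = exit X X? r xt ¬xz
  ... | no ¬xt = y , t , xy , ¬xt , e , pt

InBag : {A B : Set} → (A → B) → B → A → Set
InBag bag c y = bag y ≡ c

record Model (G H : Graph) : Set where
  field
    bag       : V G → V H
    occupied  : ∀ a → ∃ λ y → bag y ≡ a
    respects  : ∀ y z → E G y z → Touch H (bag y) (bag z)
    realises  : ∀ a b → E H a b → ∃₂ λ y z → bag y ≡ a × bag z ≡ b × E G y z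
    connected : ∀ y z → bag y ≡ bag z → Walk G (InBag bag (bag y)) y z

connected-via-hubs : {G H : Graph} → Symmetric G → (bag : V G → V H) (hub : V H → V G) →
                     (∀ y → Walk G (InBag bag (bag y)) y (hub (bag y))) →
                     ∀ y z → bag y ≡ bag z → Walk G (InBag bag (bag y)) y z
connected-via-hubs {G} sym-G bag hub to-hub y z same =
  to-hub y ++ʷ reverse sym-G (sym same) (subst (λ c → Walk G (InBag bag c) z (hub c)) (sym same) (to-hub z))

module Contraction (G : Graph) (u₀ v₀ : V G) (uv : E G u₀ v₀) where

  G/ : Graph
  G/ = contract G u₀ v₀ uv

  Merged : V G → Set
  Merged y = y ≡ u₀ ⊎ y ≡ v₀

  merged? : ∀ y → Dec (Merged y)
  merged? y = (G ._≟_) y u₀ ⊎-dec (G ._≟_) y v₀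

  kept⇒unmerged : ∀ {y} → T (notUV G u₀ v₀ y) → ¬ Merged y
  kept⇒unmerged {y} p m with (G ._≟_) y u₀ | (G ._≟_) y v₀
  ... | yes _  | _      = p
  ... | no _   | yes _  = p
  ... | no y≢u | no y≢v = [ y≢u , y≢v ] m

  unmerged⇒kept : ∀ {y} → ¬ Merged y → T (notUV G u₀ v₀ y)
  unmerged⇒kept {y} ¬m with (G ._≟_) y u₀ | (G ._≟_) y v₀
  ... | yes y≡u | _       = ¬m (inj₁ y≡u)
  ... | no _    | yes y≡v = ¬m (inj₂ y≡v)
  ... | no _    | no _    = tt

  π : V G → ContrV G u₀ v₀
  π y with merged? y
  ... | yes _  = inj₂ tt
  ... | no ¬m = inj₁ (y , unmerged⇒kept ¬m)

  ι : ContrV G u₀ v₀ → V G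
  ι (inj₁ (y , _)) = y
  ι (inj₂ _)       = v₀

  π-merged : ∀ {y} → Merged y → π y ≡ inj₂ tt
  π-merged {y} m with merged? y
  ... | yes _  = refl
  ... | no ¬m = ⊥-elim (¬m m)

  π-kept : ∀ {y} (p : T (notUV G u₀ v₀ y)) → π y ≡ inj₁ (y , p)
  π-kept {y} p with merged? y
  ... | yes m  = ⊥-elim (kept⇒unmerged p m)
  ... | no ¬m = cong (λ p′ → inj₁ (y , p′)) (T-irrelevant _ p)

  π-ι : ∀ a → π (ι a) ≡ a
  π-ι (inj₁ (y , p)) = π-kept p
  π-ι (inj₂ tt)      = π-merged (inj₂ refl)

  π-fibre : ∀ y z → π y ≡ π z → y ≡ z ⊎ (Merged y × Merged z)
  π-fibre y z same with merged? y | merged? z | same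
  ... | yes my | yes mz | _    = inj₂ (my , mz)
  ... | yes _  | no _   | ()
  ... | no _   | yes _  | ()
  ... | no _   | no _   | refl = inj₁ refl

  edge-into-merged : ∀ {y z} → E G y z → Merged z → E G y u₀ ⊎ E G y v₀
  edge-into-merged e (inj₁ refl) = inj₁ e
  edge-into-merged e (inj₂ refl) = inj₂ e

  edge-from-merged : ∀ {y z} → Merged y → E G y z → E G u₀ z ⊎ E G v₀ z
  edge-from-merged (inj₁ refl) e = inj₁ e
  edge-from-merged (inj₂ refl) e = inj₂ e

  π-edge : ∀ y z → E G y z → Touch G/ (π y) (π z)
  π-edge y z e with merged? y | merged? z
  ... | yes _  | yes _  = inj₁ refl
  ... | yes my | no _   = inj₂ (edge-from-merged my e)
  ... | no _   | yes mz = inj₂ (edge-into-merged e mz)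
  ... | no _   | no _   = inj₂ e

  lift-edge : ∀ a b → E G/ a b → ∃₂ λ y z → π y ≡ a × π z ≡ b × E G y z
  lift-edge (inj₁ (y , p)) (inj₁ (z , p′)) e     = y  , z  , π-kept p , π-kept p′ , e
  lift-edge (inj₁ (y , p)) (inj₂ tt) (inj₁ e)    = y  , u₀ , π-kept p , π-merged (inj₁ refl) , e
  lift-edge (inj₁ (y , p)) (inj₂ tt) (inj₂ e)    = y  , v₀ , π-kept p , π-merged (inj₂ refl) , e
  lift-edge (inj₂ tt) (inj₁ (z , p′)) (inj₁ e)   = u₀ , z  , π-merged (inj₁ refl) , π-kept p′ , e
  lift-edge (inj₂ tt) (inj₁ (z , p′)) (inj₂ e)   = v₀ , z  , π-merged (inj₂ refl) , π-kept p′ , e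

  contract-symmetric : Symmetric G → Symmetric G/
  contract-symmetric sym-G (inj₁ (y , _)) (inj₁ (z , _)) e = sym-G y z e
  contract-symmetric sym-G (inj₁ (y , _)) (inj₂ _) e       = [ inj₁ ∘ sym-G y u₀ , inj₂ ∘ sym-G y v₀ ] e
  contract-symmetric sym-G (inj₂ _) (inj₁ (z , _)) e       = [ inj₁ ∘ sym-G u₀ z , inj₂ ∘ sym-G v₀ z ] e

  contract-loopless : Loopless G → Loopless G/
  contract-loopless loopless-G (inj₁ (y , _)) e = loopless-G y e

  merged-walk : Symmetric G → {P : V G → Set} → ∀ {y z} → Merged y → Merged z → P z → Walk G P y z
  merged-walk sym-G (inj₁ refl) (inj₁ refl) pz = stay
  merged-walk sym-G (inj₁ refl) (inj₂ refl) pz = hop uv pz stay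
  merged-walk sym-G (inj₂ refl) (inj₁ refl) pz = hop (sym-G u₀ v₀ uv) pz stay
  merged-walk sym-G (inj₂ refl) (inj₂ refl) pz = stay

  module _ {H : Graph} where

    pushforward : Loopless H → (M : Model G H) → Model.bag M u₀ ≡ Model.bag M v₀ → Model G/ H
    pushforward loopless-H M same-bag = record
      { bag = bag′ ; occupied = occupied′ ; respects = respects′
      ; realises = realises′ ; connected = connected′ }
      where
        open Model M

        bag′ : V G/ → V H
        bag′ = bag ∘ ι

        bag′-π : ∀ y → bag′ (π y) ≡ bag y
        bag′-π y with merged? y
        ... | yes (inj₁ refl) = sym same-bag
        ... | yes (inj₂ refl) = refl
        ... | no _            = refl

        occupied′ : ∀ c → ∃ λ a → bag′ a ≡ c
        occupied′ c with occupied c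
        ... | y , y∈c = π y , trans (bag′-π y) y∈c

        respects′ : ∀ a b → E G/ a b → Touch H (bag′ a) (bag′ b)
        respects′ a b e′ with lift-edge a b e′
        ... | y , z , refl , refl , e =
          subst₂ (Touch H) (sym (bag′-π y)) (sym (bag′-π z)) (respects y z e)

        realises′ : ∀ c d → E H c d → ∃₂ λ a b → bag′ a ≡ c × bag′ b ≡ d × E G/ a b
        realises′ c d eH with realises c d eH
        ... | y , z , y∈c , z∈d , e with π-edge y z e
        ...   | inj₂ e′ = π y , π z , trans (bag′-π y) y∈c , trans (bag′-π z) z∈d , e′
        ...   | inj₁ collapsed = ⊥-elim (loopless-H d (subst (λ t → E H t d) c≡d eH))
          where
            open ≡-Reasoning
            c≡d : c ≡ d
            c≡d = begin
              c            ≡⟨ sym y∈c ⟩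
              bag y        ≡⟨ sym (bag′-π y) ⟩
              bag′ (π y)   ≡⟨ cong bag′ collapsed ⟩
              bag′ (π z)   ≡⟨ bag′-π z ⟩
              bag z        ≡⟨ z∈d ⟩
              d            ∎

        push-walk : ∀ {c y z} → Walk G (InBag bag c) y z → Walk G/ (InBag bag′ c) (π y) (π z)
        push-walk stay = stay
        push-walk {c} {z = z} (hop {y} {t} e t∈c r) with π-edge y t e
        ... | inj₁ collapsed = subst (λ a → Walk G/ (InBag bag′ c) a (π z)) (sym collapsed) (push-walk r)
        ... | inj₂ e′        = hop e′ (trans (bag′-π t) t∈c) (push-walk r)

        connected′ : ∀ a b → bag′ a ≡ bag′ b → Walk G/ (InBag bag′ (bag′ a)) a b
        connected′ a b same =
          subst₂ (Walk G/ (InBag bag′ (bag′ a))) (π-ι a) (π-ι b) (push-walk (connected (ι a) (ι b) same))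

    pullback : Symmetric G → Model G/ H → Model G H
    pullback sym-G M′ = record
      { bag = bag ; occupied = occupied ; respects = respects
      ; realises = realises ; connected = connected }
      where
        open Model M′ renaming (bag to bag′; occupied to occupied′; respects to respects′;
                                 realises to realises′; connected to connected′)

        bag : V G → V H
        bag = bag′ ∘ π

        occupied : ∀ c → ∃ λ y → bag y ≡ c
        occupied c with occupied′ c
        ... | a , a∈c = ι a , trans (cong bag′ (π-ι a)) a∈c

        respects : ∀ y z → E G y z → Touch H (bag y) (bag z)
        respects y z e with π-edge y z e
        ... | inj₁ collapsed = inj₁ (cong bag′ collapsed)
        ... | inj₂ e′        = respects′ (π y) (π z) e′

        realises : ∀ c d → E H c d → ∃₂ λ y z → bag y ≡ c × bag z ≡ d × E G y z
        realises c d eH with realises′ c d eH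
        ... | a , b , a∈c , b∈d , e′ with lift-edge a b e′
        ...   | y , z , refl , refl , e = y , z , a∈c , b∈d , e

        within-fibre : ∀ {c} y z → π y ≡ π z → bag z ≡ c → Walk G (InBag bag c) y z
        within-fibre y z same z∈c with π-fibre y z same
        ... | inj₁ refl       = stay
        ... | inj₂ (my , mz) = merged-walk sym-G my mz z∈c

        lift-walk : ∀ {c a b} → Walk G/ (InBag bag′ c) a b →
                    ∀ y z → π y ≡ a → π z ≡ b → bag′ a ≡ c → Walk G (InBag bag c) y z
        lift-walk stay y z refl z↦a a∈c = within-fibre y z (sym z↦a) (trans (cong bag′ z↦a) a∈c)
        lift-walk (hop {a} {t} e′ t∈c r) y z refl z↦b a∈c with lift-edge a t e′
        ... | y₁ , y₂ , y₁↦a , refl , e =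
          within-fibre y y₁ (sym y₁↦a) (trans (cong bag′ y₁↦a) a∈c) ++ʷ hop e t∈c (lift-walk r y₂ z refl z↦b t∈c)

        connected : ∀ y z → bag y ≡ bag z → Walk G (InBag bag (bag y)) y z
        connected y z same = lift-walk (connected′ (π y) (π z) same) y z refl refl refl

iso-model : ∀ {G H} → G ≅ H → Model G H
iso-model {G} {H} (f , preserves) = record
  { bag = to ; occupied = λ a → from a , strictlyInverseˡ a ; respects = λ y z e → inj₂ (Equivalence.to (preserves y z) e)
  ; realises = realises ; connected = connected }
  where
    open Inverse f

    realises : ∀ a b → E H a b → ∃₂ λ y z → to y ≡ a × to z ≡ b × E G y z
    realises a b eH = from a , from b , strictlyInverseˡ a , strictlyInverseˡ b ,
      Equivalence.from (preserves (from a) (from b))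
        (subst₂ (E H) (sym (strictlyInverseˡ a)) (sym (strictlyInverseˡ b)) eH)

    connected : ∀ y z → to y ≡ to z → Walk G (InBag to (to y)) y z
    connected y z same with trans (sym (strictlyInverseʳ y)) (trans (cong from same) (strictlyInverseʳ z))
    ... | refl = stay

model-iso : ∀ {G H} → Loopless G → (M : Model G H) →
            (∀ y z → Model.bag M y ≡ Model.bag M z → y ≡ z) → G ≅ H
model-iso {G} {H} loopless-G M injective = f , λ y z → mk⇔ (preserve y z) (reflect y z)
  where
    open Model M

    f : V G ↔ V H
    f = mk↔ₛ′ bag (proj₁ ∘ occupied) (proj₂ ∘ occupied) (λ y → injective _ _ (proj₂ (occupied (bag y))))

    preserve : ∀ y z → E G y z → E H (bag y) (bag z)
    preserve y z e with respects y z e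
    ... | inj₁ same = ⊥-elim (loopless-G y (subst (E G y) (sym (injective y z same)) e))
    ... | inj₂ eH   = eH

    reflect : ∀ y z → E H (bag y) (bag z) → E G y z
    reflect y z eH with realises (bag y) (bag z) eH
    ... | y′ , z′ , y′∈y , z′∈z , e = subst₂ (E G) (injective _ _ y′∈y) (injective _ _ z′∈z) e

contraction⇒model : ∀ {G H} → Symmetric G → ContainsContraction G H → Model G H
contraction⇒model sym-G (done iso)       = iso-model iso
contraction⇒model {G} sym-G (step u₀ v₀ e c) =
  pullback sym-G (contraction⇒model (contract-symmetric sym-G) c)
  where open Contraction G u₀ v₀ e

injective-or-collision : {A B : Set} → DecidableEquality A → DecidableEquality B →
                         (L : List A) → (∀ y → y ∈ᴸ L) → (f : A → B) →
                         (∀ y z → f y ≡ f z → y ≡ z) ⊎ (∃₂ λ y z → y ≢ z × f y ≡ f z)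
injective-or-collision _≟ᴬ_ _≟ᴮ_ L enum f
  with any? (λ y → any? (λ z → ¬? (y ≟ᴬ z) ×-dec (f y ≟ᴮ f z)) L) L
... | no none = inj₁ injective
  where
    injective : ∀ y z → f y ≡ f z → y ≡ z
    injective y z same with y ≟ᴬ z
    ... | yes y≡z = y≡z
    ... | no y≢z  = ⊥-elim (none (lose (enum y) (lose (enum z) (y≢z , same))))
... | yes collision with satisfied collision
...   | y , some-z with satisfied some-z
...     | z , y≢z , same = inj₂ (y , z , y≢z , same)

-- A model of a loopless H in a finite loopless G gives a contraction of G to
-- H: while some bag has two vertices, contract an edge inside it.
model⇒contraction : ∀ {G H} → Loopless G → Loopless H → (L : List (V G)) → (∀ y → y ∈ᴸ L) →
                    Model G H → ContainsContraction G H
model⇒contraction {H = H} loopless-G loopless-H L enum M =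
  shrink loopless-G L enum M (<-wellFounded (length L))
  where
    shrink : ∀ {G} → Loopless G → (L : List (V G)) → (∀ y → y ∈ᴸ L) → Model G H →
             Acc _<_ (length L) → ContainsContraction G H
    shrink {G} loopless-G L enum M (acc smaller)
      with injective-or-collision (G ._≟_) (H ._≟_) L enum (Model.bag M)
    ... | inj₁ injective = done (model-iso loopless-G M injective)
    ... | inj₂ (y , z , y≢z , same)
      with first-hop (Model.connected M y z same) y≢z
    ...   | t , e , t∈y =
      step y t e (shrink (contract-loopless loopless-G) L′ enum′ (pushforward loopless-H M (sym t∈y)) (smaller shorter))
      where
        open Contraction G y t e

        y≢t : y ≢ t
        y≢t y≡t = loopless-G y (subst (E G y) (sym y≡t) e)

        not-y? : ∀ r → Dec (r ≢ y)
        not-y? r = ¬? ((G ._≟_) r y)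

        -- The vertices other than y, projected, still enumerate G/.
        L′ : List (V G/)
        L′ = map π (filter not-y? L)

        ι≢y : ∀ a → ι a ≢ y
        ι≢y (inj₁ (r , p)) r≡y = kept⇒unmerged p (inj₁ r≡y)
        ι≢y (inj₂ _)       t≡y = y≢t (sym t≡y)

        enum′ : ∀ a → a ∈ᴸ L′
        enum′ a = subst (_∈ᴸ L′) (π-ι a) (∈-map⁺ π (∈-filter⁺ not-y? (enum (ι a)) (ι≢y a)))

        shorter : length L′ < length L
        shorter = subst (_< length L) (sym (length-map π (filter not-y? L)))
                    (filter-notAll not-y? L (lose (enum y) (λ y≢y → y≢y refl)))

subset-of : ∀ {m} {P : Fin m → Set} → (∀ i → Dec (P i)) → Subset m
subset-of P? = tabulate (does ∘ P?)

∈-subset-of⁺ : ∀ {m} {P : Fin m → Set} (P? : ∀ i → Dec (P i)) {i} → P i → i ∈ subset-of P?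
∈-subset-of⁺ P? {i} p = lookup⇒[]= i (subset-of P?) (trans (lookup∘tabulate (does ∘ P?) i) (dec-true (P? i) p))

∈-subset-of⁻ : ∀ {m} {P : Fin m → Set} (P? : ∀ i → Dec (P i)) {i} → i ∈ subset-of P? → P i
∈-subset-of⁻ P? {i} i∈ with P? i | trans (sym (lookup∘tabulate (does ∘ P?) i)) ([]=⇒lookup i∈)
... | yes p | _  = p
... | no _  | ()

infixl 6 _⊕_
_⊕_ : Fin 6 → ℕ → Fin 6
a ⊕ zero  = a
a ⊕ suc k = next6 (a ⊕ k)

pos : ℕ → Fin 6
pos k = zero ⊕ k

C6-symmetric : Symmetric C6
C6-symmetric a b = [ inj₂ , inj₁ ]

touch-sym : ∀ {a b} → Touch C6 a b → Touch C6 b a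
touch-sym {a} {b} = [ inj₁ ∘ sym , inj₂ ∘ C6-symmetric a b ]

touch? : ∀ a b → Dec (Touch C6 a b)
touch? a b = (a Fin.≟ b) ⊎-dec ((b Fin.≟ next6 a) ⊎-dec (a Fin.≟ next6 b))

moves : ∀ a → a ⊕ 1 ≢ a
moves = toWitness {a? = all? λ a → ¬? (a ⊕ 1 Fin.≟ a)} tt

moves-back : ∀ a → a ⊕ 5 ≢ a
moves-back = toWitness {a? = all? λ a → ¬? (a ⊕ 5 Fin.≟ a)} tt

skips : ∀ a → a ⊕ 2 ≢ a
skips = toWitness {a? = all? λ a → ¬? (a ⊕ 2 Fin.≟ a)} tt

far : ∀ b y z → Touch C6 y z → Touch C6 z b → y ≢ b ⊕ 3
far = toWitness {a? = all? λ b → all? λ y → all? λ z →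
                   touch? y z →-dec (touch? z b →-dec ¬? (y Fin.≟ b ⊕ 3))} tt

between₁ : ∀ b y → Touch C6 y b → Touch C6 y (b ⊕ 2) → y ≡ b ⊕ 1
between₁ = toWitness {a? = all? λ b → all? λ y → touch? y b →-dec (touch? y (b ⊕ 2) →-dec (y Fin.≟ b ⊕ 1))} tt

between₅ : ∀ b y → Touch C6 y b → Touch C6 y (b ⊕ 4) → y ≡ b ⊕ 5
between₅ = toWitness {a? = all? λ b → all? λ y → touch? y b →-dec (touch? y (b ⊕ 4) →-dec (y Fin.≟ b ⊕ 5))} tt

between₀ : ∀ b y → Touch C6 y (b ⊕ 1) → Touch C6 y (b ⊕ 5) → y ≡ b
between₀ = toWitness {a? = all? λ b → all? λ y → touch? y (b ⊕ 1) →-dec (touch? y (b ⊕ 5) →-dec (y Fin.≟ b))} tt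

C6-loopless : Loopless C6
C6-loopless a = [ moves a ∘ sym , moves a ∘ sym ]

C6-model : ∀ {G} → Symmetric G → (bag : V G → Fin 6) →
           (∀ y z → E G y z → Touch C6 (bag y) (bag z)) →
           (∀ a → ∃₂ λ y z → bag y ≡ a × bag z ≡ next6 a × E G y z) →
           (∀ y z → bag y ≡ bag z → Walk G (InBag bag (bag y)) y z) →
           Model G C6
C6-model {G} sym-G bag respects joins connected = record
  { bag = bag ; occupied = occupied ; respects = respects
  ; realises = realises ; connected = connected }
  where
    occupied : ∀ a → ∃ λ y → bag y ≡ a
    occupied a with joins a
    ... | y , _ , y∈a , _ = y , y∈a

    realises : ∀ a b → E C6 a b → ∃₂ λ y z → bag y ≡ a × bag z ≡ b × E G y z
    realises a b (inj₁ refl) = joins a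
    realises a b (inj₂ refl) with joins b
    ... | y , z , y∈b , z∈a , e = z , y , z∈a , y∈b , sym-G y z e

module Reduction (m k : ℕ) (S : Fin (suc (suc k)) → Subset m) (S-last : S (fromℕ (suc k)) ≡ ⊤) where

  last : Fin (suc (suc k))
  last = fromℕ (suc k)

  -- S_n = Q: every q_i is adjacent to S_n′, and q^i_n exists.
  ∈-last : ∀ i → i ∈ S last
  ∈-last i = subst (i ∈_) (sym S-last) ∈⊤

  G'-symmetric : Symmetric (G' S)
  G'-symmetric (q _)       (s' _)      e = e
  G'-symmetric (q _)       (qq _ _ _)  e = e
  G'-symmetric (s _)       (s' _)      e = e
  G'-symmetric (s _)       (qq _ _ _)  e = e
  G'-symmetric (s _)       u₁          e = e
  G'-symmetric (s' _)      (q _)       e = e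
  G'-symmetric (s' _)      (s _)       e = e
  G'-symmetric (s' _)      w           e = e
  G'-symmetric (qq _ _ _)  (q _)       e = e
  G'-symmetric (qq _ _ _)  (s _)       e = e
  G'-symmetric u₁          (s _)       e = e
  G'-symmetric u₁          v           e = e
  G'-symmetric v           u₁          e = e
  G'-symmetric v           x           e = e
  G'-symmetric w           (s' _)      e = e
  G'-symmetric w           x           e = e
  G'-symmetric x           v           e = e
  G'-symmetric x           w           e = e

  G'-loopless : Loopless (G' S)
  G'-loopless (q _) ()
  G'-loopless (s _) ()
  G'-loopless (s' _) ()
  G'-loopless (qq _ _ _) ()
  G'-loopless u₁ ()
  G'-loopless v ()
  G'-loopless w ()
  G'-loopless x ()

  hanging-at : ∀ i j → Dec (i ∈ S j) → List (G'V S)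
  hanging-at i j (yes p) = qq i j p ∷ []
  hanging-at i j (no _)  = []

  hanging : Fin m → List (G'V S)
  hanging i = concatMap (λ j → hanging-at i j (i ∈? S j)) (allFin (suc (suc k)))

  blocks : List (List (G'V S))
  blocks = map q (allFin m) ∷ map s (allFin (suc (suc k))) ∷ map s' (allFin (suc (suc k)))
         ∷ concatMap hanging (allFin m) ∷ (u₁ ∷ v ∷ w ∷ x ∷ []) ∷ []

  vertices : List (G'V S)
  vertices = concat blocks

  in-block : ∀ {y ys} → y ∈ᴸ ys → ys ∈ᴸ blocks → y ∈ᴸ vertices
  in-block = ∈-concat⁺′

  fixed : (u₁ ∷ v ∷ w ∷ x ∷ []) ∈ᴸ blocks
  fixed = there (there (there (there (here refl))))

  enumerated : ∀ y → y ∈ᴸ vertices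
  enumerated (q i)      = in-block (∈-map⁺ q (∈-allFin i)) (here refl)
  enumerated (s j)      = in-block (∈-map⁺ s (∈-allFin j)) (there (here refl))
  enumerated (s' j)     = in-block (∈-map⁺ s' (∈-allFin j)) (there (there (here refl)))
  enumerated (qq i j p) = in-block in-hanging (there (there (there (here refl))))
    where
      at : (d : Dec (i ∈ S j)) → qq i j p ∈ᴸ hanging-at i j d
      at (yes p′) = here (cong (qq i j) (∈-irrelevant p p′))
      at (no ¬p)  = ⊥-elim (¬p p)

      in-hanging : qq i j p ∈ᴸ concatMap hanging (allFin m)
      in-hanging = ∈-concatMap⁺ hanging (lose (∈-allFin i)
                     (∈-concatMap⁺ (λ j′ → hanging-at i j′ (i ∈? S j′)) (lose (∈-allFin j) (at (i ∈? S j)))))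
  enumerated u₁ = in-block (here refl) fixed
  enumerated v  = in-block (there (here refl)) fixed
  enumerated w  = in-block (there (there (here refl))) fixed
  enumerated x  = in-block (there (there (there (here refl)))) fixed

  -- A 2-colouring (Q₁, Q₂) gives a C₆-model: around the cycle the bags are
  -- {x}, {v}, {u₁}, {S_j, q_i, q^i_j : q_i ∈ Q₁}, {S_j′, q_i, q^i_j : q_i ∉ Q₁}, {w}.
  module FromColouring (Q₁ Q₂ : Subset m) (disjoint : Q₁ ∩ Q₂ ≡ ⊥)
                       (meets : ∀ j → Nonempty (Q₁ ∩ S j) × Nonempty (Q₂ ∩ S j)) where

    side : Fin m → Fin 6
    side i with i ∈? Q₁
    ... | yes _ = pos 3
    ... | no _  = pos 4

    side-in : ∀ {i} → i ∈ Q₁ → side i ≡ pos 3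
    side-in {i} i∈Q₁ with i ∈? Q₁
    ... | yes _    = refl
    ... | no i∉Q₁ = ⊥-elim (i∉Q₁ i∈Q₁)

    side-out : ∀ {i} → i ∉ Q₁ → side i ≡ pos 4
    side-out {i} i∉Q₁ with i ∈? Q₁
    ... | yes i∈Q₁ = ⊥-elim (i∉Q₁ i∈Q₁)
    ... | no _     = refl

    side-touches : ∀ i → Touch C6 (side i) (pos 3) × Touch C6 (side i) (pos 4)
    side-touches i with i ∈? Q₁
    ... | yes _ = inj₁ refl , inj₂ (inj₁ refl)
    ... | no _  = inj₂ (inj₂ refl) , inj₁ refl

    bag : G'V S → Fin 6
    bag (q i)      = side i
    bag (s _)      = pos 3
    bag (s' _)     = pos 4
    bag (qq i _ _) = side i
    bag u₁         = pos 2
    bag v          = pos 1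
    bag w          = pos 5
    bag x          = pos 0

    respects : ∀ y z → G'E S y z → Touch C6 (bag y) (bag z)
    respects (q i)       (s' _)      _ = proj₂ (side-touches i)
    respects (q _)       (qq _ _ _)  refl = inj₁ refl
    respects (s _)       (s' _)      _ = inj₂ (inj₁ refl)
    respects (s _)       (qq i _ _)  _ = touch-sym (proj₁ (side-touches i))
    respects (s _)       u₁          _ = inj₂ (inj₂ refl)
    respects (s' _)      (q i)       _ = touch-sym (proj₂ (side-touches i))
    respects (s' _)      (s _)       _ = inj₂ (inj₂ refl)
    respects (s' _)      w           _ = inj₂ (inj₁ refl)
    respects (qq _ _ _)  (q _)       refl = inj₁ refl
    respects (qq i _ _)  (s _)       _ = proj₁ (side-touches i)
    respects u₁          (s _)       _ = inj₂ (inj₁ refl)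
    respects u₁          v           _ = inj₂ (inj₂ refl)
    respects v           u₁          _ = inj₂ (inj₁ refl)
    respects v           x           _ = inj₂ (inj₂ refl)
    respects w           (s' _)      _ = inj₂ (inj₂ refl)
    respects w           x           _ = inj₂ (inj₁ refl)
    respects x           v           _ = inj₂ (inj₁ refl)
    respects x           w           _ = inj₂ (inj₂ refl)

    joins : ∀ a → ∃₂ λ y z → bag y ≡ a × bag z ≡ next6 a × G'E S y z
    joins zero                               = x , v , refl , refl , tt
    joins (suc zero)                         = v , u₁ , refl , refl , tt
    joins (suc (suc zero))                   = u₁ , s last , refl , refl , tt
    joins (suc (suc (suc zero)))             = s last , s' last , refl , refl , tt
    joins (suc (suc (suc (suc zero))))       = s' last , w , refl , refl , tt
    joins (suc (suc (suc (suc (suc zero))))) = w , x , refl , refl , tt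

    -- Each bag is connected through a hub; q_i reaches S_n or S_n′ directly.
    hub : Fin 6 → G'V S
    hub zero                               = x
    hub (suc zero)                         = v
    hub (suc (suc zero))                   = u₁
    hub (suc (suc (suc zero)))             = s last
    hub (suc (suc (suc (suc zero))))       = s' last
    hub (suc (suc (suc (suc (suc zero))))) = w

    BagWalk : Fin 6 → G'V S → G'V S → Set
    BagWalk c = Walk (G' S) (InBag bag c)

    q-to-hub : ∀ i → BagWalk (side i) (q i) (hub (side i))
    q-to-hub i with i ∈? Q₁
    ... | yes i∈Q₁ = hop {t = qq i last (∈-last i)} refl (side-in i∈Q₁) (hop refl refl stay)
    ... | no _     = hop {t = s' last} (∈-last i) refl stay

    q-route : ∀ i {c} → side i ≡ c → BagWalk c (q i) (hub c)
    q-route i refl = q-to-hub i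

    to-hub : ∀ y → BagWalk (bag y) y (hub (bag y))
    to-hub (q i)      = q-to-hub i
    to-hub (qq i j p) = hop refl refl (q-to-hub i)
    to-hub (s j) with proj₁ (meets j)
    ... | i , i∈Q₁∩Sj with x∈p∩q⁻ Q₁ (S j) i∈Q₁∩Sj
    ...   | i∈Q₁ , i∈Sj =
      hop {t = qq i j i∈Sj} refl (side-in i∈Q₁) (hop refl (side-in i∈Q₁) (q-route i (side-in i∈Q₁)))
    to-hub (s' j) with proj₂ (meets j)
    ... | i , i∈Q₂∩Sj with x∈p∩q⁻ Q₂ (S j) i∈Q₂∩Sj
    ...   | i∈Q₂ , i∈Sj = hop {t = q i} i∈Sj (side-out i∉Q₁) (q-route i (side-out i∉Q₁))
      where i∉Q₁ : i ∉ Q₁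
            i∉Q₁ i∈Q₁ = ∉⊥ (subst (i ∈_) disjoint (x∈p∩q⁺ (i∈Q₁ , i∈Q₂)))
    to-hub u₁ = stay
    to-hub v  = stay
    to-hub w  = stay
    to-hub x  = stay

    model : Model (G' S) C6
    model = C6-model G'-symmetric bag respects joins (connected-via-hubs {H = C6} G'-symmetric bag hub to-hub)

  module FromModel (M : Model (G' S) C6) where
    open Model M

    b : Fin 6
    b = bag (s' last)

    -- Every vertex but v lies within distance two of S_n′.
    near-S′ : ∀ y → y ≡ v ⊎ (∃ λ z → Touch C6 (bag y) (bag z) × Touch C6 (bag z) b)
    near-S′ (q i)      = inj₂ (q i , inj₁ refl , respects (q i) (s' last) (∈-last i))
    near-S′ (s j)      = inj₂ (s j , inj₁ refl , respects (s j) (s' last) tt)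
    near-S′ (s' j)     = inj₂ (s zero , respects (s' j) (s zero) tt , respects (s zero) (s' last) tt)
    near-S′ (qq i j p) = inj₂ (q i , respects (qq i j p) (q i) refl , respects (q i) (s' last) (∈-last i))
    near-S′ u₁         = inj₂ (s zero , respects u₁ (s zero) tt , respects (s zero) (s' last) tt)
    near-S′ v          = inj₁ refl
    near-S′ w          = inj₂ (w , inj₁ refl , respects w (s' last) tt)
    near-S′ x          = inj₂ (w , respects x w tt , respects w (s' last) tt)

    opposite-is-v : ∀ y → bag y ≡ b ⊕ 3 → y ≡ v
    opposite-is-v y y∈opp with near-S′ y
    ... | inj₁ y≡v             = y≡v
    ... | inj₂ (z , yz , zb) = ⊥-elim (far b _ _ yz zb y∈opp)

    v-neighbours : ∀ z → G'E S v z → z ≡ u₁ ⊎ z ≡ x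
    v-neighbours u₁ _ = inj₁ refl
    v-neighbours x  _ = inj₂ refl

    beside-opposite : ∀ c → E C6 (b ⊕ 3) c → bag u₁ ≡ c ⊎ bag x ≡ c
    beside-opposite c e with realises (b ⊕ 3) c e
    ... | y , z , y∈opp , z∈c , yz with opposite-is-v y y∈opp
    ...   | refl with v-neighbours z yz
    ...     | inj₁ refl = inj₁ z∈c
    ...     | inj₂ refl = inj₂ z∈c

    record Layout : Set where
      field
        a      : Fin 6
        S-in-a : ∀ j → bag (s j) ≡ a
        S′-in-b : ∀ j → bag (s' j) ≡ b
        a≢b    : a ≢ b
        u₁∉a   : bag u₁ ≢ a
        w∉b    : bag w ≢ b

    touch : ∀ y z → G'E S y z → ∀ {c} → bag z ≡ c → Touch C6 (bag y) c
    touch y z e refl = respects y z e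

    layout₁ : bag u₁ ≡ b ⊕ 2 → bag x ≡ b ⊕ 4 → Layout
    layout₁ u₁∈2 x∈4 = record
      { a = b ⊕ 1 ; S-in-a = S-in-a ; S′-in-b = S′-in-b ; a≢b = moves b
      ; u₁∉a = moves (b ⊕ 1) ∘ trans (sym u₁∈2) ; w∉b = moves-back b ∘ trans (sym w∈5) }
      where
        S-in-a : ∀ j → bag (s j) ≡ b ⊕ 1
        S-in-a j = between₁ b _ (touch (s j) (s' last) tt refl) (touch (s j) u₁ tt u₁∈2)
        w∈5 : bag w ≡ b ⊕ 5
        w∈5 = between₅ b _ (touch w (s' last) tt refl) (touch w x tt x∈4)
        S′-in-b : ∀ j → bag (s' j) ≡ b
        S′-in-b j = between₀ b _ (touch (s' j) (s zero) tt (S-in-a zero)) (touch (s' j) w tt w∈5)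

    layout₂ : bag x ≡ b ⊕ 2 → bag u₁ ≡ b ⊕ 4 → Layout
    layout₂ x∈2 u₁∈4 = record
      { a = b ⊕ 5 ; S-in-a = S-in-a ; S′-in-b = S′-in-b ; a≢b = moves-back b
      ; u₁∉a = moves (b ⊕ 4) ∘ sym ∘ trans (sym u₁∈4) ; w∉b = moves b ∘ trans (sym w∈1) }
      where
        S-in-a : ∀ j → bag (s j) ≡ b ⊕ 5
        S-in-a j = between₅ b _ (touch (s j) (s' last) tt refl) (touch (s j) u₁ tt u₁∈4)
        w∈1 : bag w ≡ b ⊕ 1
        w∈1 = between₁ b _ (touch w (s' last) tt refl) (touch w x tt x∈2)
        S′-in-b : ∀ j → bag (s' j) ≡ b
        S′-in-b j = between₀ b _ (touch (s' j) w tt w∈1) (touch (s' j) (s zero) tt (S-in-a zero))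

    layout : Layout
    layout with beside-opposite (b ⊕ 2) (inj₂ refl) | beside-opposite (b ⊕ 4) (inj₁ refl)
    ... | inj₁ u₁∈2 | inj₂ x∈4  = layout₁ u₁∈2 x∈4
    ... | inj₂ x∈2  | inj₁ u₁∈4 = layout₂ x∈2 u₁∈4
    ... | inj₁ u₁∈2 | inj₁ u₁∈4 = ⊥-elim (skips (b ⊕ 2) (trans (sym u₁∈4) u₁∈2))
    ... | inj₂ x∈2  | inj₂ x∈4  = ⊥-elim (skips (b ⊕ 2) (trans (sym x∈4) x∈2))

    open Layout layout

    Around : Fin (suc (suc k)) → G'V S → Set
    Around j (s j′)      = j′ ≡ j
    Around j (qq _ j′ _) = j′ ≡ j
    Around j _           = Empty

    around? : ∀ j y → Dec (Around j y)
    around? j (s j′)      = j′ Fin.≟ j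
    around? j (qq _ j′ _) = j′ Fin.≟ j
    around? j (q _)       = no λ ()
    around? j (s' _)      = no λ ()
    around? j u₁          = no λ ()
    around? j v           = no λ ()
    around? j w           = no λ ()
    around? j x           = no λ ()

    leave-around : ∀ j y z → Around j y → ¬ Around j z → G'E S y z → bag z ≡ a →
                   ∃ λ i → i ∈ S j × bag (q i) ≡ a
    leave-around j (s _)      (s' j′)    _    _  _    z∈a = ⊥-elim (a≢b (trans (sym z∈a) (S′-in-b j′)))
    leave-around j (s _)      (qq _ _ _) refl ¬z refl _   = ⊥-elim (¬z refl)
    leave-around j (s _)      u₁         _    _  _    z∈a = ⊥-elim (u₁∉a z∈a)
    leave-around j (qq i _ p) (q _)      refl _  refl z∈a = i , p , z∈a
    leave-around j (qq _ _ _) (s _)      refl ¬z refl _   = ⊥-elim (¬z refl)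

    At′ : Fin (suc (suc k)) → G'V S → Set
    At′ j (s' j′) = j′ ≡ j
    At′ j _       = Empty

    at′? : ∀ j y → Dec (At′ j y)
    at′? j (s' j′)     = j′ Fin.≟ j
    at′? j (q _)       = no λ ()
    at′? j (s _)       = no λ ()
    at′? j (qq _ _ _)  = no λ ()
    at′? j u₁          = no λ ()
    at′? j v           = no λ ()
    at′? j w           = no λ ()
    at′? j x           = no λ ()

    leave-S′ : ∀ j y z → At′ j y → G'E S y z → bag z ≡ b → ∃ λ i → i ∈ S j × bag (q i) ≡ b
    leave-S′ j (s' _) (q i)  refl i∈Sj z∈b = i , i∈Sj , z∈b
    leave-S′ j (s' _) (s j′) refl _    z∈b = ⊥-elim (a≢b (trans (sym (S-in-a j′)) z∈b))
    leave-S′ j (s' _) w      refl _    z∈b = ⊥-elim (w∉b z∈b)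

    -- A second hyperedge index, available since n ≥ 2.
    other : Fin (suc (suc k)) → Fin (suc (suc k))
    other zero    = suc zero
    other (suc _) = zero

    other-≢ : ∀ j → other j ≢ j
    other-≢ zero    ()
    other-≢ (suc _) ()

    S-walk : ∀ j → Walk (G' S) (InBag bag (bag (s j))) (s j) (s (other j))
    S-walk j = connected (s j) (s (other j)) (trans (S-in-a j) (sym (S-in-a (other j))))

    S′-walk : ∀ j → Walk (G' S) (InBag bag (bag (s' j))) (s' j) (s' (other j))
    S′-walk j = connected (s' j) (s' (other j)) (trans (S′-in-b j) (sym (S′-in-b (other j))))

    meets-a : ∀ j → ∃ λ i → i ∈ S j × bag (q i) ≡ a
    meets-a j with exit (Around j) (around? j) (S-walk j) refl (other-≢ j)
    ... | y , z , y∈ , z∉ , e , z∈a = leave-around j y z y∈ z∉ e (trans z∈a (S-in-a j))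

    meets-b : ∀ j → ∃ λ i → i ∈ S j × bag (q i) ≡ b
    meets-b j with exit (At′ j) (at′? j) (S′-walk j) refl (other-≢ j)
    ... | y , z , y∈ , _ , e , z∈b = leave-S′ j y z y∈ e (trans z∈b (S′-in-b j))

    in-a? : ∀ i → Dec (bag (q i) ≡ a)
    in-a? i = bag (q i) Fin.≟ a

    Q₁ : Subset m
    Q₁ = subset-of in-a?

    colouring : TwoColouring S
    colouring = Q₁ , ∁ Q₁ , p∪∁p≡⊤ Q₁ , ∩-inverseʳ Q₁ , λ j → in-Q₁ j , in-∁Q₁ j
      where
        in-Q₁ : ∀ j → Nonempty (Q₁ ∩ S j)
        in-Q₁ j with meets-a j
        ... | i , i∈Sj , i∈a = i , x∈p∩q⁺ (∈-subset-of⁺ in-a? i∈a , i∈Sj)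

        in-∁Q₁ : ∀ j → Nonempty (∁ Q₁ ∩ S j)
        in-∁Q₁ j with meets-b j
        ... | i , i∈Sj , i∈b = i , x∈p∩q⁺ (x∉p⇒x∈∁p i∉Q₁ , i∈Sj)
          where i∉Q₁ : i ∉ Q₁
                i∉Q₁ i∈Q₁ = a≢b (trans (sym (∈-subset-of⁻ in-a? i∈Q₁)) i∈b)

-- Lemma 6.
lemma6 : (m k : ℕ) (S : Fin (suc (suc k)) → Subset m) →
           (∀ j → Nonempty (S j)) →
           S (fromℕ (suc k)) ≡ ⊤ →
           TwoColouring S ⇔ ContainsContraction (G' S) C6
lemma6 m k S _ S-last = mk⇔ colouring⇒contraction contraction⇒colouring
  where
    open Reduction m k S S-last

    colouring⇒contraction : TwoColouring S → ContainsContraction (G' S) C6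
    colouring⇒contraction (Q₁ , Q₂ , _ , disjoint , meets) =
      model⇒contraction G'-loopless C6-loopless vertices enumerated (FromColouring.model Q₁ Q₂ disjoint meets)

    contraction⇒colouring : ContainsContraction (G' S) C6 → TwoColouring S
    contraction⇒colouring c = FromModel.colouring (contraction⇒model G'-symmetric c)
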